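{- Let $k\ge 3$ with $k\neq 5$, and let $F=v_1v_2\cdots v_kv_1$ be a cycle of length $k$. Then there are maps $C:V(F)\to\{1,2,3,4\}$ and $U:V(F)\to\{1,2,3,4\}$ such that: for every vertex $v$ of $F$, some neighbor $w$ of $v$ on $F$ has $C(w)=U(v)$ and $U(v)$ is the color of exactly one neighbor of $v$ on $F$; $C(v)\neq U(v)$ for all $v$; and for every edge $\{v,w\}$ of $F$, $C(v)\neq C(w)$ and $|\{C(v),U(v),C(w),U(w)\}|=3$.
   Context: This is the coloring of a single (uncolored) face $F$ of an outerplanar graph with $|V(F)|\neq 5$ using $4$ colors while satisfying the invariants: each colored vertex has a uniquely colored neighbor of color $U(v)\neq C(v)$, adjacent vertices receive different colors, and the four values $C(v),U(v),C(w),U(w)$ of each edge span exactly three colors. -}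

module Defs where

open import Data.Nat using (ℕ; zero; suc; _+_; _%_; NonZero)
open import Data.Nat.DivMod using (_mod_)
open import Data.Fin using (Fin; toℕ; _≟_)
open import Data.List using (List; _∷_; []; filter; length; allFin)
open import Data.List.Membership.DecPropositional (_≟_ {4}) using (_∈?_)
open import Data.Product using (Σ; _×_; _,_)
open import Relation.Binary.PropositionalEquality using (_≡_; _≢_)

Colour : Set
Colour = Fin 4

-- The cycle F = v_1 v_2 ... v_k v_1 on vertex set Fin k (k ≥ 1):
-- vertex i is followed by vertex (i+1) mod k.
next : (k : ℕ) → .{{_ : NonZero k}} → Fin k → Fin k
next k i = (suc (toℕ i)) mod k

Adj : (k : ℕ) → .{{_ : NonZero k}} → Fin k → Fin k → Set
Adj k v w = (w ≡ next k v) ⊎' (v ≡ next k w)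
  where
  open import Data.Sum using () renaming (_⊎_ to _⊎'_)

numColours : List Colour → ℕ
numColours xs = length (filter (λ c → c ∈? xs) (allFin 4))

UniqueNbr : (k : ℕ) → .{{_ : NonZero k}} → (C U : Fin k → Colour) → Fin k → Set
UniqueNbr k C U v =
  Σ (Fin k) λ w → Adj k v w × C w ≡ U v ×
    ((w' : Fin k) → Adj k v w' → C w' ≡ U v → w' ≡ w)

GoodColouring : (k : ℕ) → .{{_ : NonZero k}} → (C U : Fin k → Colour) → Set
GoodColouring k C U =
  ((v : Fin k) → UniqueNbr k C U v) ×
  ((v : Fin k) → C v ≢ U v) ×
  ((v w : Fin k) → Adj k v w →
     (C v ≢ C w) × numColours (C v ∷ U v ∷ C w ∷ U w ∷ []) ≡ 3)

module Submission where

-- Call a colouring C of the cycle F "2-proper" if any three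
-- consecutive vertices v, next v, next (next v) receive three distinct
-- colours, i.e. C is a proper colouring of the square of F.  For such a C,
-- the choice U(v) = C(next v) satisfies all invariants: the successor is the
-- unique neighbour of colour U(v) (the predecessor differs from it, being two
-- steps behind next v), and each edge {v , next v} sees exactly the three
-- colours C(v), C(next v), C(next (next v)).
--
-- A 2-proper colouring of the k-cycle exists for every k ≥ 3 with k ≠ 5:
-- write k as a sum of 3s and 4s and read the colours off the periodic word
-- obtained by concatenating blocks 0 1 2 and 0 1 2 3.  Every block begins with
-- 0 1, so every window of three consecutive letters, including the two that
-- wrap around the end of the cycle, is repetition-free.

open import Defs
open import Data.Nat using (ℕ; zero; suc; _+_; _%_; _<_; s≤s; z≤n; NonZero)
open import Data.Nat.Properties using (<-cmp; ≤-antisym; ≤-pred; m<n⇒m<1+n)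
open import Data.Nat.DivMod using (m%n%n≡m%n; m<n⇒m%n≡m; n%n≡0; [m+n]%n≡m%n; %-distribˡ-+)
open import Data.Fin using (Fin; zero; suc; toℕ; _≟_)
open import Data.Fin.Properties using (toℕ<n; toℕ-fromℕ<; all?)
open import Data.List using (List; []; _∷_; length)
open import Data.Product using (Σ; _×_; _,_; proj₁; proj₂)
open import Data.Sum using (inj₁; inj₂)
open import Data.Unit using (⊤; tt)
open import Data.Empty using (⊥-elim)
open import Relation.Nullary.Decidable using (Dec; ¬?; _×-dec_; _→-dec_; True; toWitness)
open import Relation.Binary using (tri<; tri≈; tri>)
open import Relation.Binary.PropositionalEquality
  using (_≡_; _≢_; refl; sym; trans; cong; subst; subst₂; module ≡-Reasoning)
import Data.Nat as ℕ

Distinct3 : Colour → Colour → Colour → Set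
Distinct3 a b c = a ≢ b × b ≢ c × a ≢ c

distinct3? : (a b c : Colour) → Dec (Distinct3 a b c)
distinct3? a b c = ¬? (a ≟ b) ×-dec ¬? (b ≟ c) ×-dec ¬? (a ≟ c)

distinct : {a b c : Colour} {_ : True (distinct3? a b c)} → Distinct3 a b c
distinct {a} {b} {c} {isDistinct} = toWitness {a? = distinct3? a b c} isDistinct

-- The two colour lists met on an edge of a 2-proper colouring both contain
-- exactly three colours; checked by running through all 64 triples.
numColours-edge : (a b c : Colour) → Distinct3 a b c →
  numColours (a ∷ b ∷ b ∷ c ∷ []) ≡ 3 × numColours (b ∷ c ∷ a ∷ b ∷ []) ≡ 3
numColours-edge = toWitness {a? = all? λ a → all? λ b → all? λ c →
  distinct3? a b c →-dec
    (numColours (a ∷ b ∷ b ∷ c ∷ []) ℕ.≟ 3 ×-dec numColours (b ∷ c ∷ a ∷ b ∷ []) ℕ.≟ 3)} tt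

TwoProper : (k : ℕ) → .{{_ : NonZero k}} → (Fin k → Colour) → Set
TwoProper k C = (v : Fin k) → Distinct3 (C v) (C (next k v)) (C (next k (next k v)))

twoProper⇒good : (k : ℕ) .{{_ : NonZero k}} (C : Fin k → Colour) →
  TwoProper k C → GoodColouring k C (λ v → C (next k v))
twoProper⇒good k C proper = uniqueNbr , (λ v → proj₁ (proper v)) , edge
  where
  -- The predecessor w of v has colour ≠ C(next v), as w, v, next v are consecutive.
  uniqueNbr : (v : Fin k) → UniqueNbr k C (λ v → C (next k v)) v
  uniqueNbr v = next k v , inj₁ refl , refl , onlySuccessor
    where
    onlySuccessor : (w : Fin k) → Adj k v w → C w ≡ C (next k v) → w ≡ next k v
    onlySuccessor w (inj₁ w≡next) _ = w≡next
    onlySuccessor w (inj₂ refl) same = ⊥-elim (proj₂ (proj₂ (proper w)) same)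

  edge : (v w : Fin k) → Adj k v w →
    (C v ≢ C w) × numColours (C v ∷ C (next k v) ∷ C w ∷ C (next k w) ∷ []) ≡ 3
  edge v w (inj₁ refl) = proj₁ (proper v) , proj₁ (numColours-edge _ _ _ (proper v))
  edge v w (inj₂ refl) =
    (λ e → proj₁ (proper w) (sym e)) , proj₂ (numColours-edge _ _ _ (proper w))

toℕ-next : (k : ℕ) .{{_ : NonZero k}} (v : Fin k) → toℕ (next k v) ≡ suc (toℕ v) % k
toℕ-next k v = toℕ-fromℕ< _

toℕ-next² : (k : ℕ) .{{_ : NonZero k}} (v : Fin k) →
  toℕ (next k (next k v)) ≡ suc (suc (toℕ v)) % k
toℕ-next² k v = begin
  toℕ (next k (next k v))           ≡⟨ toℕ-next k (next k v) ⟩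
  (1 + toℕ (next k v)) % k          ≡⟨ cong (λ x → (1 + x) % k) (toℕ-next k v) ⟩
  (1 + suc (toℕ v) % k) % k         ≡⟨ %-distribˡ-+ 1 (suc (toℕ v) % k) k ⟩
  (1 % k + suc (toℕ v) % k % k) % k ≡⟨ cong (λ x → (1 % k + x) % k) (m%n%n≡m%n (suc (toℕ v)) k) ⟩
  (1 % k + suc (toℕ v) % k) % k     ≡⟨ %-distribˡ-+ 1 (suc (toℕ v)) k ⟨
  (2 + toℕ v) % k                   ∎
  where open ≡-Reasoning

-- Let f list the colours of a closed walk around the cycle of length
-- k = 2 + m: positions 0 … k-1 are the vertices, and positions k, k+1 repeat
-- 0, 1.  Then every position below k + 2 may be read modulo k.
closedWalk-mod : (m : ℕ) (f : ℕ → Colour) → f (2 + m) ≡ f 0 → f (3 + m) ≡ f 1 →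
  (q : ℕ) → q < 4 + m → f (q % (2 + m)) ≡ f q
closedWalk-mod m f wrap₀ wrap₁ q q<k+2 with <-cmp q (2 + m)
... | tri< q<k _ _ = cong f (m<n⇒m%n≡m q<k)
... | tri≈ _ refl _ = trans (cong f (n%n≡0 (2 + m))) (sym wrap₀)
... | tri> _ _ k<q with ≤-antisym k<q (≤-pred q<k+2)
...   | refl = trans (cong f (trans ([m+n]%n≡m%n 1 (2 + m)) (m<n⇒m%n≡m {n = 2 + m} (s≤s (s≤s z≤n)))))
                     (sym wrap₁)

closedWalk⇒twoProper : (m : ℕ) (f : ℕ → Colour) →
  f (2 + m) ≡ f 0 → f (3 + m) ≡ f 1 →
  ((p : ℕ) → p < 2 + m → Distinct3 (f p) (f (1 + p)) (f (2 + p))) →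
  TwoProper (2 + m) (λ v → f (toℕ v))
closedWalk⇒twoProper m f wrap₀ wrap₁ windows v =
  subst₂ (Distinct3 (f p)) (sym at-next) (sym at-next²) (windows p (toℕ<n v))
  where
  p : ℕ
  p = toℕ v

  at-next : f (toℕ (next (2 + m) v)) ≡ f (1 + p)
  at-next = trans (cong f (toℕ-next (2 + m) v))
                  (closedWalk-mod m f wrap₀ wrap₁ (1 + p) (s≤s (m<n⇒m<1+n (toℕ<n v))))

  at-next² : f (toℕ (next (2 + m) (next (2 + m) v))) ≡ f (2 + p)
  at-next² = trans (cong f (toℕ-next² (2 + m) v))
                   (closedWalk-mod m f wrap₀ wrap₁ (2 + p) (s≤s (s≤s (toℕ<n v))))

-- Reading the i-th letter of a word (the default colour beyond its end).
_‼_ : List Colour → ℕ → Colour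
[] ‼ _ = zero
(c ∷ _) ‼ zero = c
(_ ∷ w) ‼ suc p = w ‼ p

Windows : List Colour → Set
Windows (a ∷ b ∷ c ∷ w) = Distinct3 a b c × Windows (b ∷ c ∷ w)
Windows _ = ⊤

window-at : (w : List Colour) → Windows w → (p : ℕ) → 2 + p < length w →
  Distinct3 (w ‼ p) (w ‼ (1 + p)) (w ‼ (2 + p))
window-at (a ∷ b ∷ c ∷ w) (abc , _) zero _ = abc
window-at (a ∷ b ∷ c ∷ w) (_ , rest) (suc p) (s≤s bound) = window-at (b ∷ c ∷ w) rest p bound
window-at (a ∷ []) _ zero (s≤s ())
window-at (a ∷ b ∷ []) _ zero (s≤s (s≤s ()))
window-at (a ∷ b ∷ []) _ (suc p) (s≤s (s≤s ()))

c0 c1 c2 c3 : Colour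
c0 = zero
c1 = suc zero
c2 = suc (suc zero)
c3 = suc (suc (suc zero))

data Block : Set where
  three four : Block

-- The concatenation of the blocks followed by the opening 0 1 again, written
-- with the leading 0 1 split off: each block contributes its letters after
-- 0 1, then the 0 1 that opens the next block (or closes the walk).
blockTails : List Block → List Colour
blockTails [] = []
blockTails (three ∷ bs) = c2 ∷ c0 ∷ c1 ∷ blockTails bs
blockTails (four ∷ bs) = c2 ∷ c3 ∷ c0 ∷ c1 ∷ blockTails bs

closedWord : List Block → List Colour
closedWord bs = c0 ∷ c1 ∷ blockTails bs

windows-closedWord : (bs : List Block) → Windows (closedWord bs)
windows-closedWord [] = tt
windows-closedWord (three ∷ bs) =
  distinct , distinct , distinct , windows-closedWord bs
windows-closedWord (four ∷ bs) =
  distinct , distinct , distinct , distinct , windows-closedWord bs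

closedWord-wraps : (bs : List Block) {k : ℕ} → length (blockTails bs) ≡ k →
  closedWord bs ‼ k ≡ c0 × closedWord bs ‼ suc k ≡ c1
closedWord-wraps [] refl = refl , refl
closedWord-wraps (three ∷ bs) refl = closedWord-wraps bs refl
closedWord-wraps (four ∷ bs) refl = closedWord-wraps bs refl

closedWord-twoProper : (bs : List Block) (m : ℕ) → length (blockTails bs) ≡ 2 + m →
  TwoProper (2 + m) (λ v → closedWord bs ‼ toℕ v)
closedWord-twoProper bs m length≡ =
  closedWalk⇒twoProper m (closedWord bs ‼_)
    (proj₁ (closedWord-wraps bs length≡)) (proj₂ (closedWord-wraps bs length≡))
    λ p p<k → window-at (closedWord bs) (windows-closedWord bs) p
                (s≤s (s≤s (subst (p <_) (sym length≡) p<k)))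

decompose : (n : ℕ) → 3 + n ≢ 5 → Σ (List Block) λ bs → length (blockTails bs) ≡ 3 + n
decompose 0 _ = three ∷ [] , refl
decompose 1 _ = four ∷ [] , refl
decompose 2 k≢5 = ⊥-elim (k≢5 refl)
decompose 3 _ = three ∷ three ∷ [] , refl
decompose 4 _ = three ∷ four ∷ [] , refl
decompose 5 _ = four ∷ four ∷ [] , refl
decompose (suc (suc (suc n@(suc (suc (suc _)))))) _ with decompose n (λ ())
... | bs , length≡ = three ∷ bs , cong (3 +_) length≡

lemma3 : (n : ℕ) → 3 + n ≢ 5 →
    Σ (Fin (3 + n) → Colour) λ C → Σ (Fin (3 + n) → Colour) λ U →
      GoodColouring (3 + n) C U
lemma3 n k≢5 with decompose n k≢5
... | bs , length≡ = C , (λ v → C (next (3 + n) v)) , twoProper⇒good (3 + n) C proper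
  where
  C : Fin (3 + n) → Colour
  C v = closedWord bs ‼ toℕ v

  proper : TwoProper (3 + n) C
  proper = closedWord-twoProper bs (suc n) length≡
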